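{- If there is a representation for a pair $(G,G')$, then no edge of $G'$ lies on a hole (chordless cycle) of $G$ of length greater than $3$.
   Context: A representation $\langle T,\mathcal P\rangle$: a tree $T$ and a family $\mathcal P=(P_v)_{v\in V}$ of simple paths of $T$ with at least one edge. Paths intersect if they share an edge; $\mathrm{split}(P,P')$ is the set of vertices of degree $\ge3$ in $P\cup P'$; $P\sim P'$ means intersecting with empty split set. A pair $(G,G')$ consists of graphs with $V(G)=V(G')$ and $E(G')\subseteq E(G)$; a representation of it satisfies: $uv\in E(G)$ iff $P_u,P_v$ intersect, and $uv\in E(G')$ iff $P_u\sim P_v$. A hole of $G$ is an induced cycle of $G$. -}

module Defs where

open import Data.Nat using (ℕ; zero; suc; _≤_; _<_)
open import Data.Fin using (Fin; toℕ)
open import Data.List using (List; []; _∷_; length)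
open import Data.List.Relation.Unary.Unique.Propositional using (Unique)
open import Data.Product using (Σ; ∃; ∃-syntax; _×_; _,_)
open import Data.Sum using (_⊎_)
open import Relation.Nullary using (¬_)
open import Relation.Binary.PropositionalEquality using (_≡_; _≢_)
open import Relation.Binary.Construct.Closure.ReflexiveTransitive using (Star)
open import Function.Definitions using (Injective)

record Graph (n : ℕ) : Set₁ where
  field
    Adj    : Fin n → Fin n → Set
    sym    : ∀ {x y} → Adj x y → Adj y x
    irrefl : ∀ {x} → ¬ Adj x x
open Graph public

CycNext : (k : ℕ) → Fin k → Fin k → Set
CycNext k i j = (suc (toℕ i) ≡ toℕ j) ⊎ ((suc (toℕ i) ≡ k) × (toℕ j ≡ 0))

IsCycle : ∀ {n} → Graph n → (k : ℕ) → (Fin k → Fin n) → Set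
IsCycle G k f =
  (3 ≤ k) × Injective _≡_ _≡_ f × (∀ i j → CycNext k i j → Adj G (f i) (f j))

IsHole : ∀ {n} → Graph n → (k : ℕ) → (Fin k → Fin n) → Set
IsHole G k f =
  IsCycle G k f ×
  (∀ i j → i ≢ j → ¬ CycNext k i j → ¬ CycNext k j i → ¬ Adj G (f i) (f j))

record Tree (m : ℕ) : Set₁ where
  field
    graph     : Graph m
    connected : ∀ a b → Star (Adj graph) a b
    acyclic   : ∀ k (f : Fin k → Fin m) → ¬ IsCycle graph k f
open Tree public

data Consec {A : Set} : List A → A → A → Set where
  here  : ∀ {x y xs} → Consec (x ∷ y ∷ xs) x y
  there : ∀ {x a b xs} → Consec xs a b → Consec (x ∷ xs) a b

data Chain {A : Set} (R : A → A → Set) : List A → Set where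
  []  : Chain R []
  [-] : ∀ {x} → Chain R (x ∷ [])
  _∷_ : ∀ {x y xs} → R x y → Chain R (y ∷ xs) → Chain R (x ∷ y ∷ xs)

IsPath : ∀ {m} → Tree m → List (Fin m) → Set
IsPath T p = (2 ≤ length p) × Unique p × Chain (Adj (graph T)) p

EdgeOf : ∀ {m} → List (Fin m) → Fin m → Fin m → Set
EdgeOf p a b = Consec p a b ⊎ Consec p b a

Intersect : ∀ {m} → List (Fin m) → List (Fin m) → Set
Intersect p q = ∃[ a ] ∃[ b ] (EdgeOf p a b × EdgeOf q a b)

InUnion : ∀ {m} → List (Fin m) → List (Fin m) → Fin m → Fin m → Set
InUnion p q x y = EdgeOf p x y ⊎ EdgeOf q x y

InSplit : ∀ {m} → List (Fin m) → List (Fin m) → Fin m → Set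
InSplit p q x = ∃[ y₁ ] ∃[ y₂ ] ∃[ y₃ ]
  ((y₁ ≢ y₂) × (y₁ ≢ y₃) × (y₂ ≢ y₃) ×
   InUnion p q x y₁ × InUnion p q x y₂ × InUnion p q x y₃)

_∼_ : ∀ {m} → List (Fin m) → List (Fin m) → Set
p ∼ q = Intersect p q × (∀ x → ¬ InSplit p q x)

record Representation {n : ℕ} (G G' : Graph n) : Set₁ where
  field
    m     : ℕ
    T     : Tree m
    P     : Fin n → List (Fin m)
    path  : ∀ v → IsPath T (P v)
    edgeG  : ∀ u v → u ≢ v → (Adj G u v → Intersect (P u) (P v)) × (Intersect (P u) (P v) → Adj G u v)
    edgeG' : ∀ u v → u ≢ v → (Adj G' u v → P u ∼ P v) × (P u ∼ P v → Adj G' u v)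

-- Rotate the hole so that the edge in question is v₀v₁, and let st be a tree edge shared by
-- P₀ ∼ P₁.  No other vᵢ is adjacent to both v₀ and v₁, so no other path uses st; as v₂ … v_{k−1}
-- is a path of G, their tree paths all lie in one component of T − st, say that of s.  Walking
-- away from st on the side of s, P₀ and P₁ cannot part ways, since the vertex where they did
-- would lie in split(P₀, P₁); so on that side one of them contains the other.  Hence the edge
-- P_{k−1} shares with P₀ lies on P₁, or the edge P₂ shares with P₁ lies on P₀, giving a chord
-- v_{k−1}v₁ or v₂v₀ because k ≥ 4.

module Submission where

open import Defs
open import Data.Nat using (ℕ; zero; suc; _+_; _≤_; z≤n; s≤s)
import Data.Nat as ℕ
open import Data.Nat.Properties using (suc-injective; <-irrefl)
open import Data.Fin using (Fin; toℕ; zero; suc; fromℕ; inject₁; _≟_)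
open import Data.Fin.Properties using (toℕ-injective; toℕ<n; toℕ-fromℕ; toℕ-inject₁)
open import Data.Fin.Relation.Unary.Top using (view; ‵fromℕ; ‵inject₁)
open import Data.Fin.Induction using (<-weakInduction)
open import Data.List using (List; []; _∷_; _++_; _ʳ++_; length; lookup)
open import Data.List.Properties using (++-ʳ++)
open import Data.List.Membership.Propositional using (_∈_; _∉_)
open import Data.List.Membership.Propositional.Properties using (∈-lookup)
import Data.List.Membership.DecPropositional as DecMembership
open import Data.List.Relation.Unary.Any using (here; there)
open import Data.List.Relation.Unary.All.Properties using (¬Any⇒All¬)
open import Data.List.Relation.Unary.AllPairs using ([]; _∷_)
open import Data.List.Relation.Unary.Unique.Propositional using (Unique)
open import Data.List.Relation.Unary.Unique.Propositional.Properties using (Unique[x∷xs]⇒x∉xs)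
open import Data.List.Relation.Binary.Disjoint.Propositional using (Disjoint)
open import Data.List.Relation.Binary.Prefix.Heterogeneous using (Prefix; []; _∷_)
open import Data.Product using (∃; ∃₂; _×_; _,_; proj₁; proj₂)
open import Data.Sum as Sum using (_⊎_; inj₁; inj₂)
open import Data.Empty using (⊥; ⊥-elim)
open import Relation.Nullary using (¬_; yes; no)
open import Relation.Nullary.Decidable using (_⊎-dec_; _×-dec_)
open import Function using (_∘_; case_of_)
open import Relation.Binary.Definitions using (DecidableEquality; Decidable)
open import Relation.Binary.PropositionalEquality
  using (_≡_; _≢_; refl; trans; cong; subst; subst₂) renaming (sym to ≡-sym)
open import Relation.Binary.Construct.Closure.ReflexiveTransitive as Star using (Star; ε; _◅_; _◅◅_)

module _ {A : Set} where

  Unique-∷ : ∀ {x : A} {xs} → x ∉ xs → Unique xs → Unique (x ∷ xs)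
  Unique-∷ x∉xs u = ¬Any⇒All¬ _ x∉xs ∷ u

  Unique-tail : ∀ {x : A} {xs} → Unique (x ∷ xs) → Unique xs
  Unique-tail (_ ∷ u) = u

  Consec-∈ : ∀ {xs : List A} {a b} → Consec xs a b → a ∈ xs × b ∈ xs
  Consec-∈ here      = here refl , there (here refl)
  Consec-∈ (there c) = there (proj₁ (Consec-∈ c)) , there (proj₂ (Consec-∈ c))

  Chain-Consec : ∀ {R : A → A → Set} {xs a b} → Chain R xs → Consec xs a b → R a b
  Chain-Consec (r ∷ _) here      = r
  Chain-Consec (_ ∷ c) (there q) = Chain-Consec c q
  Chain-Consec [-]     (there ())

  Chain-tail : ∀ {R : A → A → Set} {x xs} → Chain R (x ∷ xs) → Chain R xs
  Chain-tail [-]     = []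
  Chain-tail (_ ∷ c) = c

  Chain-map : ∀ {R S : A → A → Set} → (∀ {a b} → R a b → S a b) → ∀ {xs} → Chain R xs → Chain S xs
  Chain-map f []      = []
  Chain-map f [-]     = [-]
  Chain-map f (r ∷ c) = f r ∷ Chain-map f c

  Consec⇒ʳ++ : ∀ {P : List A} {u w} → Consec P u w → ∃₂ λ B C → P ≡ B ʳ++ u ∷ w ∷ C
  Consec⇒ʳ++ here = [] , _ , refl
  Consec⇒ʳ++ (there {x} c) with B , C , refl ← Consec⇒ʳ++ c = B ++ x ∷ [] , C , ≡-sym (++-ʳ++ B)

  Consec-ʳ++⁺ʳ : ∀ B {c : A} {l x y} → Consec (c ∷ l) x y → Consec (B ʳ++ c ∷ l) x y
  Consec-ʳ++⁺ʳ []      q = q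
  Consec-ʳ++⁺ʳ (a ∷ B) q = Consec-ʳ++⁺ʳ B (there q)

  Consec-ʳ++⁺ˡ : ∀ B {c : A} {l x y} → Consec (c ∷ B) y x → Consec (B ʳ++ c ∷ l) x y
  Consec-ʳ++⁺ˡ []      (there ())
  Consec-ʳ++⁺ˡ (a ∷ B) here      = Consec-ʳ++⁺ʳ B here
  Consec-ʳ++⁺ˡ (a ∷ B) (there q) = Consec-ʳ++⁺ˡ B q

  Consec-ʳ++⁻ : ∀ B {c : A} {l x y} → Consec (B ʳ++ c ∷ l) x y → Consec (c ∷ B) y x ⊎ Consec (c ∷ l) x y
  Consec-ʳ++⁻ []      q = inj₂ q
  Consec-ʳ++⁻ (a ∷ B) q with Consec-ʳ++⁻ B q
  ... | inj₁ q′         = inj₁ (there q′)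
  ... | inj₂ here       = inj₁ here
  ... | inj₂ (there q′) = inj₂ q′

  Unique-ʳ++⁻ : ∀ B {l : List A} → Unique (B ʳ++ l) → Unique B × Unique l × Disjoint B l
  Unique-ʳ++⁻ []      u = [] , u , λ ()
  Unique-ʳ++⁻ (a ∷ B) u with uB , a∷l , B#a∷l ← Unique-ʳ++⁻ B u =
    Unique-∷ (λ a∈B → B#a∷l (a∈B , here refl)) uB , Unique-tail a∷l , λ where
      (here refl , a∈l) → Unique[x∷xs]⇒x∉xs a∷l a∈l
      (there v∈B , v∈l) → B#a∷l (v∈B , there v∈l)

  data Last : List A → A → Set where
    end  : ∀ {x} → Last (x ∷ []) x
    more : ∀ {x y xs} → Last xs y → Last (x ∷ xs) y

  lookup-injective : ∀ (xs : List A) → Unique xs → ∀ i j → lookup xs i ≡ lookup xs j → i ≡ j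
  lookup-injective (x ∷ xs) u zero    zero    _ = refl
  lookup-injective (x ∷ xs) u zero    (suc j) e =
    ⊥-elim (Unique[x∷xs]⇒x∉xs u (subst (_∈ xs) (≡-sym e) (∈-lookup j)))
  lookup-injective (x ∷ xs) u (suc i) zero    e =
    ⊥-elim (Unique[x∷xs]⇒x∉xs u (subst (_∈ xs) e (∈-lookup i)))
  lookup-injective (x ∷ xs) u (suc i) (suc j) e = cong suc (lookup-injective xs (Unique-tail u) i j e)

  Chain-lookup : ∀ {R : A → A → Set} {xs} → Chain R xs →
                 ∀ i j → suc (toℕ i) ≡ toℕ j → R (lookup xs i) (lookup xs j)
  Chain-lookup (r ∷ _) zero    (suc zero)    refl = r
  Chain-lookup (_ ∷ c) (suc i) (suc j)       e    = Chain-lookup c i j (suc-injective e)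
  Chain-lookup (_ ∷ _) zero    (suc (suc _)) ()
  Chain-lookup (_ ∷ _) _       zero          ()
  Chain-lookup [-]     zero    zero          ()

  Last-lookup : ∀ {xs y} → Last xs y → ∀ i → suc (toℕ i) ≡ length xs → lookup xs i ≡ y
  Last-lookup end             zero    refl = refl
  Last-lookup (more l)        (suc i) e    = Last-lookup l i (suc-injective e)
  Last-lookup (more end)      zero    ()
  Last-lookup (more (more _)) zero    ()

  module _ (_≟_ : DecidableEquality A) {R : A → A → Set} where
    open DecMembership _≟_ using (_∈?_)

    after : ∀ {x : A} l → x ∈ l → List A
    after (_ ∷ l) (here _)  = l
    after (_ ∷ l) (there p) = after l p

    Unique-after : ∀ {x} l (p : x ∈ l) → Unique l → Unique (x ∷ after l p)
    Unique-after (_ ∷ _) (here refl) u = u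
    Unique-after (_ ∷ l) (there p)   u = Unique-after l p (Unique-tail u)

    Chain-after : ∀ {x} l (p : x ∈ l) → Chain R l → Chain R (x ∷ after l p)
    Chain-after (_ ∷ _) (here refl) c = c
    Chain-after (_ ∷ l) (there p)   c = Chain-after l p (Chain-tail c)

    Last-after : ∀ {x y} l (p : x ∈ l) → Last l y → Last (x ∷ after l p) y
    Last-after (_ ∷ _)  (here refl) c        = c
    Last-after (_ ∷ l)  (there p)   (more c) = Last-after l p c
    Last-after (_ ∷ []) (there ())  end

    -- Loop erasure: a repeated vertex cuts off the part of the path before it.
    walk⇒path : ∀ {x y} → Star R x y → ∃ λ q → Unique (x ∷ q) × Chain R (x ∷ q) × Last (x ∷ q) y
    walk⇒path ε = [] , Unique-∷ (λ ()) [] , [-] , end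
    walk⇒path {x} (_◅_ {j = z} r w) with q , u , c , l ← walk⇒path w | x ∈? (z ∷ q)
    ... | yes p = after (z ∷ q) p , Unique-after _ p u , Chain-after _ p c , Last-after _ p l
    ... | no x∉ = z ∷ q , Unique-∷ x∉ u , r ∷ c , more l

module _ {m : ℕ} where

  EdgeOf-sym : ∀ {p : List (Fin m)} {a b} → EdgeOf p a b → EdgeOf p b a
  EdgeOf-sym (inj₁ c) = inj₂ c
  EdgeOf-sym (inj₂ c) = inj₁ c

  EdgeOf-∈ : ∀ {p : List (Fin m)} {a b} → EdgeOf p a b → a ∈ p
  EdgeOf-∈ (inj₁ c) = proj₁ (Consec-∈ c)
  EdgeOf-∈ (inj₂ c) = proj₂ (Consec-∈ c)

  EdgeOf-map : ∀ {p q : List (Fin m)} → (∀ {a b} → Consec p a b → Consec q a b) →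
               ∀ {a b} → EdgeOf p a b → EdgeOf q a b
  EdgeOf-map f = Sum.map f f

  EdgeOf-pair : ∀ {p : List (Fin m)} {s t a b} → EdgeOf (s ∷ t ∷ []) a b → EdgeOf p a b → EdgeOf p s t
  EdgeOf-pair (inj₁ here) e = e
  EdgeOf-pair (inj₂ here) e = EdgeOf-sym e
  EdgeOf-pair (inj₁ (there (there ()))) _
  EdgeOf-pair (inj₂ (there (there ()))) _

  EdgeOf-pair-swap : ∀ {s t a b : Fin m} → EdgeOf (s ∷ t ∷ []) a b → EdgeOf (t ∷ s ∷ []) a b
  EdgeOf-pair-swap (inj₁ here) = inj₂ here
  EdgeOf-pair-swap (inj₂ here) = inj₁ here
  EdgeOf-pair-swap (inj₁ (there (there ())))
  EdgeOf-pair-swap (inj₂ (there (there ())))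

  Prefix-Consec : ∀ {xs ys : List (Fin m)} → Prefix _≡_ xs ys →
                  ∀ {z a b} → Consec (z ∷ xs) a b → Consec (z ∷ ys) a b
  Prefix-Consec (refl ∷ _) here      = here
  Prefix-Consec (refl ∷ p) (there q) = there (Prefix-Consec p q)
  Prefix-Consec []         (there ())

EdgeOf-Adj : ∀ {m} (G : Graph m) {P} → Chain (Adj G) P → ∀ {x y} → EdgeOf P x y → Adj G x y
EdgeOf-Adj G c (inj₁ q) = Chain-Consec c q
EdgeOf-Adj G c (inj₂ q) = sym G (Chain-Consec c q)

-- Cycles and holes

closedPath⇒cycle : ∀ {n} (G : Graph n) {x y : Fin n} xs → 3 ≤ length (x ∷ xs) → Unique (x ∷ xs) →
                   Chain (Adj G) (x ∷ xs) → Last (x ∷ xs) y → Adj G y x →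
                   IsCycle G (length (x ∷ xs)) (lookup (x ∷ xs))
closedPath⇒cycle G {x} xs 3≤ u c l yx = 3≤ , lookup-injective _ u _ _ , adjacent
  where
    adjacent : ∀ i j → CycNext (length (x ∷ xs)) i j → Adj G (lookup (x ∷ xs) i) (lookup (x ∷ xs) j)
    adjacent i j       (inj₁ e)       = Chain-lookup c i j e
    adjacent i zero    (inj₂ (e , _)) = subst (λ v → Adj G v x) (≡-sym (Last-lookup l i e)) yx
    adjacent i (suc j) (inj₂ (_ , ()))

Neighbours : ∀ {k} → Fin k → Fin k → Set
Neighbours {k} x y = CycNext k x y ⊎ CycNext k y x

CycNext? : ∀ k → Decidable (CycNext k)
CycNext? k i j = (suc (toℕ i) ℕ.≟ toℕ j) ⊎-dec ((suc (toℕ i) ℕ.≟ k) ×-dec (toℕ j ℕ.≟ 0))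

hole-neighbours : ∀ {n k} {G : Graph n} {f : Fin k → Fin n} → IsHole G k f →
                  ∀ {x y} → x ≢ y → Adj G (f x) (f y) → Neighbours x y
hole-neighbours {k = k} (_ , chordless) {x} {y} x≢y a with CycNext? k x y | CycNext? k y x
... | yes xy | _      = inj₁ xy
... | no _   | yes yx = inj₂ yx
... | no ¬xy | no ¬yx = ⊥-elim (chordless x y x≢y ¬xy ¬yx a)

CycNext-functional : ∀ {k} {i j j′ : Fin k} → CycNext k i j → CycNext k i j′ → j ≡ j′
CycNext-functional (inj₁ p)       (inj₁ q)       = toℕ-injective (trans (≡-sym p) q)
CycNext-functional (inj₂ (_ , p)) (inj₂ (_ , q)) = toℕ-injective (trans p (≡-sym q))
CycNext-functional {j = j}   (inj₁ p)       (inj₂ (q , _)) = ⊥-elim (<-irrefl (trans (≡-sym p) q) (toℕ<n j))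
CycNext-functional {j′ = j′} (inj₂ (p , _)) (inj₁ q)       = ⊥-elim (<-irrefl (trans (≡-sym q) p) (toℕ<n j′))

CycNext-injective : ∀ {k} {i i′ j : Fin k} → CycNext k i j → CycNext k i′ j → i ≡ i′
CycNext-injective (inj₁ p)       (inj₁ q)       = toℕ-injective (suc-injective (trans p (≡-sym q)))
CycNext-injective (inj₂ (p , _)) (inj₂ (q , _)) = toℕ-injective (suc-injective (trans p (≡-sym q)))
CycNext-injective (inj₁ p)       (inj₂ (_ , q)) with () ← trans p q
CycNext-injective (inj₂ (_ , p)) (inj₁ q)       with () ← trans q p

module _ {k : ℕ} where

  next : Fin (suc k) → Fin (suc k)
  next i with view i
  ... | ‵fromℕ      = zero
  ... | ‵inject₁ j = suc j

  prev : Fin (suc k) → Fin (suc k)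
  prev zero    = fromℕ k
  prev (suc j) = inject₁ j

  CycNext-next : ∀ i → CycNext (suc k) i (next i)
  CycNext-next i with view i
  ... | ‵fromℕ      = inj₂ (cong suc (toℕ-fromℕ k) , refl)
  ... | ‵inject₁ j = inj₁ (cong suc (toℕ-inject₁ j))

  CycNext-prev : ∀ j → CycNext (suc k) (prev j) j
  CycNext-prev zero    = inj₂ (cong suc (toℕ-fromℕ k) , refl)
  CycNext-prev (suc j) = inj₁ (cong suc (toℕ-inject₁ j))

  CycNext⇒≡next : ∀ {i j} → CycNext (suc k) i j → j ≡ next i
  CycNext⇒≡next c = CycNext-functional c (CycNext-next _)

  next-injective : ∀ {i j} → next i ≡ next j → i ≡ j
  next-injective {i} {j} e =
    CycNext-injective (CycNext-next i) (subst (CycNext _ j) (≡-sym e) (CycNext-next j))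

  CycNext-next⁺ : ∀ {i j} → CycNext (suc k) i j → CycNext (suc k) (next i) (next j)
  CycNext-next⁺ {i} c =
    subst (λ j → CycNext _ (next i) (next j)) (≡-sym (CycNext⇒≡next c)) (CycNext-next (next i))

  CycNext-next⁻ : ∀ {i j} → CycNext (suc k) (next i) (next j) → CycNext (suc k) i j
  CycNext-next⁻ {i} c = subst (CycNext _ i) (next-injective (≡-sym (CycNext⇒≡next c))) (CycNext-next i)

  IsHole-∘next : ∀ {n} {G : Graph n} {f : Fin (suc k) → Fin n} →
                 IsHole G (suc k) f → IsHole G (suc k) (f ∘ next)
  IsHole-∘next ((3≤k , f-inj , f-adj) , chordless) =
      (3≤k , next-injective ∘ f-inj , λ i j c → f-adj _ _ (CycNext-next⁺ c))
    , λ i j i≢j ¬ij ¬ji → chordless _ _ (i≢j ∘ next-injective) (¬ij ∘ CycNext-next⁻) (¬ji ∘ CycNext-next⁻)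

  rotation-wlog : ∀ {A : Set} (Good : (Fin (suc k) → A) → Set) (R : A → A → Set) →
                  (∀ {f} → Good f → Good (f ∘ next)) →
                  (∀ {f} → Good f → R (f zero) (f (next zero))) →
                  ∀ {f} → Good f → ∀ i j → CycNext (suc k) i j → R (f i) (f j)
  rotation-wlog Good R rotate first good i = <-weakInduction Claim base step i good
    where
      Claim : Fin (suc k) → Set _
      Claim i = ∀ {f} → Good f → ∀ j → CycNext (suc k) i j → R (f i) (f j)
      base : Claim zero
      base {f} g j c = subst (R (f zero) ∘ f) (≡-sym (CycNext⇒≡next c)) (first g)
      step : ∀ i → Claim (inject₁ i) → Claim (suc i)
      step i claim {f} g j c = subst₂ (λ u v → R (f u) (f v)) i↦ j↦ (claim (rotate g) (prev j) c′)
        where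
          i↦ : next (inject₁ i) ≡ suc i
          i↦ = ≡-sym (CycNext⇒≡next (inj₁ (cong suc (toℕ-inject₁ i))))
          j↦ : next (prev j) ≡ j
          j↦ = ≡-sym (CycNext⇒≡next (CycNext-prev j))
          c′ : CycNext (suc k) (inject₁ i) (prev j)
          c′ = CycNext-next⁻ (subst₂ (CycNext (suc k)) (≡-sym i↦) (≡-sym j↦) c)

module _ {k : ℕ} where

  inner : Fin (2 + k) → Fin (4 + k)
  inner y = suc (suc y)

  CycNext-inner : ∀ y → CycNext (4 + k) (inner (inject₁ y)) (inner (suc y))
  CycNext-inner y = inj₁ (cong (3 +_) (toℕ-inject₁ y))

  CycNext-inner-last : CycNext (4 + k) (inner (fromℕ (1 + k))) zero
  CycNext-inner-last = inj₂ (cong (3 +_) (toℕ-fromℕ (1 + k)) , refl)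

  inner-not-next-to-both : ∀ y → Neighbours (inner y) zero → ¬ Neighbours (inner y) (suc zero)
  inner-not-next-to-both zero    (inj₁ (inj₁ ()))
  inner-not-next-to-both zero    (inj₁ (inj₂ (() , _)))
  inner-not-next-to-both zero    (inj₂ (inj₁ ()))
  inner-not-next-to-both zero    (inj₂ (inj₂ (() , _)))
  inner-not-next-to-both (suc y) _ (inj₁ (inj₁ ()))
  inner-not-next-to-both (suc y) _ (inj₁ (inj₂ (_ , ())))
  inner-not-next-to-both (suc y) _ (inj₂ (inj₁ ()))
  inner-not-next-to-both (suc y) _ (inj₂ (inj₂ (() , _)))

-- Trees with one edge removed

module TreeMinusEdge {m : ℕ} (T : Tree m) (s t : Fin m) where

  Off : Fin m → Fin m → Set
  Off x y = Adj (graph T) x y × ¬ EdgeOf (s ∷ t ∷ []) x y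

  infix 4 _≈_
  _≈_ : Fin m → Fin m → Set
  _≈_ = Star Off

  ≈-sym : ∀ {x y} → x ≈ y → y ≈ x
  ≈-sym = Star.reverse (λ (a , ¬st) → sym (graph T) a , ¬st ∘ EdgeOf-sym)

  edge-separates : Adj (graph T) s t → ¬ s ≈ t
  edge-separates st w with walk⇒path _≟_ w
  ... | []         , _ , _       , more ()
  ... | []         , _ , _       , end      = irrefl (graph T) st
  ... | _ ∷ []     , _ , (r ∷ _) , more end = proj₂ r (inj₁ here)
  ... | z ∷ z′ ∷ q , u , c       , l        = acyclic T _ _
    (closedPath⇒cycle (graph T) (z ∷ z′ ∷ q) (s≤s (s≤s (s≤s z≤n))) u (Chain-map proj₁ c) l (sym (graph T) st))

  sides : ∀ x → s ≈ x ⊎ t ≈ x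
  sides x = extend (connected T s x) (inj₁ ε)
    where
      open DecMembership _≟_ using (_∈?_)
      extend : ∀ {u v} → Star (Adj (graph T)) u v → s ≈ u ⊎ t ≈ u → s ≈ v ⊎ t ≈ v
      extend ε                         side = side
      extend {u} (_◅_ {j = w} a walk) side with w ∈? s ∷ t ∷ []
      ... | yes (here refl)         = extend walk (inj₁ ε)
      ... | yes (there (here refl)) = extend walk (inj₂ ε)
      ... | no w∉ = extend walk (Sum.map (_◅◅ uw) (_◅◅ uw) side)
        where
          uw : u ≈ w
          uw = (a , w∉ ∘ EdgeOf-∈ ∘ EdgeOf-sym) ◅ ε

  ray-≈ : ∀ {x xs} → (∀ {a b} → Consec (x ∷ xs) a b → Off a b) → ∀ {z} → z ∈ x ∷ xs → x ≈ z
  ray-≈ off (here refl)                 = ε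
  ray-≈ {xs = _ ∷ _} off (there z∈) = off here ◅ ray-≈ (off ∘ there) z∈

  path-≈ : ∀ {Q} → Chain (Adj (graph T)) Q → ¬ EdgeOf Q s t → ∀ {x y} → x ∈ Q → y ∈ Q → x ≈ y
  path-≈ {_ ∷ _} c ¬st x∈ y∈ = ≈-sym (ray-≈ off x∈) ◅◅ ray-≈ off y∈
    where
      off : ∀ {a b} → Consec _ a b → Off a b
      off q = Chain-Consec c q , λ e → ¬st (EdgeOf-pair e (inj₁ q))

  SideEdge : List (Fin m) → Fin m → Fin m → Set
  SideEdge P c d = EdgeOf P c d × ¬ EdgeOf (s ∷ t ∷ []) c d × s ≈ c

-- Two paths through a common edge

module _ {m : ℕ} where

  -- P = reverse sRay ++ s ∷ t ∷ tRay, up to the orientation of P.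
  record Rays (P : List (Fin m)) (s t : Fin m) : Set where
    field
      sRay tRay : List (Fin m)
      unique-s  : Unique (t ∷ s ∷ sRay)
      unique-t  : Unique (s ∷ t ∷ tRay)
      sRay⊆P    : ∀ {a b} → Consec (t ∷ s ∷ sRay) a b → EdgeOf P a b
      tRay⊆P    : ∀ {a b} → Consec (s ∷ t ∷ tRay) a b → EdgeOf P a b
      edges     : ∀ {a b} → EdgeOf P a b →
                  EdgeOf (s ∷ sRay) a b ⊎ EdgeOf (s ∷ t ∷ []) a b ⊎ EdgeOf (t ∷ tRay) a b

  Rays-swap : ∀ {P s t} → Rays P s t → Rays P t s
  Rays-swap r = record
    { sRay = tRay ; tRay = sRay ; unique-s = unique-t ; unique-t = unique-s
    ; sRay⊆P = tRay⊆P ; tRay⊆P = sRay⊆P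
    ; edges = λ e → case edges e of λ where
        (inj₁ x)        → inj₂ (inj₂ x)
        (inj₂ (inj₁ x)) → inj₂ (inj₁ (EdgeOf-pair-swap x))
        (inj₂ (inj₂ x)) → inj₁ x
    }
    where open Rays r

  Rays-ʳ++ : ∀ B {s t C} → Unique (B ʳ++ s ∷ t ∷ C) → Rays (B ʳ++ s ∷ t ∷ C) s t
  Rays-ʳ++ B {s} {t} {C} u = record
    { sRay = B ; tRay = C ; unique-s = unique-s ; unique-t = unique-stC
    ; sRay⊆P = λ where
        here      → inj₂ (Consec-ʳ++⁺ʳ B here)
        (there q) → inj₂ (Consec-ʳ++⁺ˡ B q)
    ; tRay⊆P = inj₁ ∘ Consec-ʳ++⁺ʳ B
    ; edges = λ where
        (inj₁ q) → classify q
        (inj₂ q) → Sum.map EdgeOf-sym (Sum.map EdgeOf-sym EdgeOf-sym) (classify q)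
    }
    where
      unique-stC : Unique (s ∷ t ∷ C)
      unique-stC = proj₁ (proj₂ (Unique-ʳ++⁻ B u))
      B#stC : Disjoint B (s ∷ t ∷ C)
      B#stC = proj₂ (proj₂ (Unique-ʳ++⁻ B u))
      unique-s : Unique (t ∷ s ∷ B)
      unique-s = Unique-∷ (λ where
                   (here t≡s)  → Unique[x∷xs]⇒x∉xs unique-stC (here (≡-sym t≡s))
                   (there t∈B) → B#stC (t∈B , there (here refl)))
                 (Unique-∷ (λ s∈B → B#stC (s∈B , here refl)) (proj₁ (Unique-ʳ++⁻ B u)))
      classify : ∀ {a b} → Consec (B ʳ++ s ∷ t ∷ C) a b →
                 EdgeOf (s ∷ B) a b ⊎ EdgeOf (s ∷ t ∷ []) a b ⊎ EdgeOf (t ∷ C) a b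
      classify q with Consec-ʳ++⁻ B q
      ... | inj₁ q′         = inj₁ (inj₂ q′)
      ... | inj₂ here       = inj₂ (inj₁ (inj₁ here))
      ... | inj₂ (there q′) = inj₂ (inj₂ (inj₁ q′))

  rays : ∀ {P s t} → Unique P → EdgeOf P s t → Rays P s t
  rays u (inj₁ q) with B , C , refl ← Consec⇒ʳ++ q = Rays-ʳ++ B u
  rays u (inj₂ q) with B , C , refl ← Consec⇒ʳ++ q = Rays-swap (Rays-ʳ++ B u)

  EdgeOf-sRay⊆P : ∀ {P s t} (r : Rays P s t) → ∀ {c d} → EdgeOf (s ∷ Rays.sRay r) c d → EdgeOf P c d
  EdgeOf-sRay⊆P r = Sum.[ Rays.sRay⊆P r ∘ there , EdgeOf-sym ∘ Rays.sRay⊆P r ∘ there ]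

  splitFree⇒nested : ∀ {P Q : List (Fin m)} → (∀ x → ¬ InSplit P Q x) →
                     ∀ {p z} X Y → Unique (p ∷ z ∷ X) → Unique (p ∷ z ∷ Y) →
                     (∀ {a b} → Consec (p ∷ z ∷ X) a b → EdgeOf P a b) →
                     (∀ {a b} → Consec (p ∷ z ∷ Y) a b → EdgeOf Q a b) →
                     Prefix _≡_ X Y ⊎ Prefix _≡_ Y X
  splitFree⇒nested free []      _       _  _  _  _  = inj₁ []
  splitFree⇒nested free (_ ∷ _) []      _  _  _  _  = inj₂ []
  splitFree⇒nested free {p} {z} (x ∷ X) (y ∷ Y) uX uY PX QY with x ≟ y
  ... | yes refl = Sum.map (refl ∷_) (refl ∷_)
                     (splitFree⇒nested free X Y (Unique-tail uX) (Unique-tail uY) (PX ∘ there) (QY ∘ there))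
  ... | no x≢y  = ⊥-elim (free z (p , x , y , p≢x , p≢y , x≢y ,
                     inj₁ (EdgeOf-sym (PX here)) , inj₁ (PX (there here)) , inj₂ (QY (there here))))
    where
      p≢x : p ≢ x
      p≢x e = Unique[x∷xs]⇒x∉xs uX (there (here e))
      p≢y : p ≢ y
      p≢y e = Unique[x∷xs]⇒x∉xs uY (there (here e))

module _ {m : ℕ} (T : Tree m) {s t : Fin m} (st : Adj (graph T) s t) where
  open TreeMinusEdge T s t

  SideEdge⇒sRay : ∀ {P} → Chain (Adj (graph T)) P → (r : Rays P s t) →
                  ∀ {c d} → SideEdge P c d → EdgeOf (s ∷ Rays.sRay r) c d
  SideEdge⇒sRay chain r (e , ¬st , s≈c) with Rays.edges r e
  ... | inj₁ q        = q
  ... | inj₂ (inj₁ q) = ⊥-elim (¬st q)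
  ... | inj₂ (inj₂ q) = ⊥-elim (edge-separates st (s≈c ◅◅ ≈-sym (ray-≈ off (EdgeOf-∈ q))))
    where
      off : ∀ {a b} → Consec (t ∷ Rays.tRay r) a b → Off a b
      off q = EdgeOf-Adj (graph T) chain (Rays.tRay⊆P r (there q))
            , λ e → Unique[x∷xs]⇒x∉xs (Rays.unique-t r) (EdgeOf-∈ (EdgeOf-pair e (inj₁ q)))

  sides-nested : ∀ {P Q} → Unique P → Unique Q → Chain (Adj (graph T)) P → Chain (Adj (graph T)) Q →
                 EdgeOf P s t → EdgeOf Q s t → (∀ x → ¬ InSplit P Q x) →
                 (∀ {c d} → SideEdge P c d → EdgeOf Q c d) ⊎ (∀ {c d} → SideEdge Q c d → EdgeOf P c d)
  sides-nested {P} {Q} uP uQ cP cQ stP stQ free = nested (rays uP stP) (rays uQ stQ)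
    where
      nested : (rP : Rays P s t) (rQ : Rays Q s t) →
               (∀ {c d} → SideEdge P c d → EdgeOf Q c d) ⊎ (∀ {c d} → SideEdge Q c d → EdgeOf P c d)
      nested rP rQ with splitFree⇒nested free (Rays.sRay rP) (Rays.sRay rQ)
                          (Rays.unique-s rP) (Rays.unique-s rQ) (Rays.sRay⊆P rP) (Rays.sRay⊆P rQ)
      ... | inj₁ X⊑Y = inj₁ (EdgeOf-sRay⊆P rQ ∘ EdgeOf-map (Prefix-Consec X⊑Y) ∘ SideEdge⇒sRay cP rP)
      ... | inj₂ Y⊑X = inj₂ (EdgeOf-sRay⊆P rP ∘ EdgeOf-map (Prefix-Consec Y⊑X) ∘ SideEdge⇒sRay cQ rQ)

-- The edge between the first two vertices of a hole

module FirstEdge {n k : ℕ} {G G' : Graph n} (R : Representation G G')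
                 {f : Fin (4 + k) → Fin n} (hole : IsHole G (4 + k) f) where
  open Representation R

  Path : Fin (4 + k) → List (Fin m)
  Path x = P (f x)

  private
    f-injective : ∀ {x y} → f x ≡ f y → x ≡ y
    f-injective = proj₁ (proj₂ (proj₁ hole))
    f-adjacent : ∀ x y → CycNext (4 + k) x y → Adj G (f x) (f y)
    f-adjacent = proj₂ (proj₂ (proj₁ hole))
    chordless : ∀ x y → x ≢ y → ¬ CycNext (4 + k) x y → ¬ CycNext (4 + k) y x → ¬ Adj G (f x) (f y)
    chordless = proj₂ hole
    unique : ∀ x → Unique (Path x)
    unique x = proj₁ (proj₂ (path (f x)))
    chain : ∀ x → Chain (Adj (graph T)) (Path x)
    chain x = proj₂ (proj₂ (path (f x)))

  intersect⇒adj : ∀ {x y} → x ≢ y → Intersect (Path x) (Path y) → Adj G (f x) (f y)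
  intersect⇒adj x≢y = proj₂ (edgeG _ _ (x≢y ∘ f-injective))

  consecutive-intersect : ∀ {x y} → CycNext (4 + k) x y → Intersect (Path x) (Path y)
  consecutive-intersect {x} {y} c = proj₁ (edgeG _ _ fx≢fy) fxy
    where
      fxy : Adj G (f x) (f y)
      fxy = f-adjacent x y c
      fx≢fy : f x ≢ f y
      fx≢fy e = irrefl G (subst (Adj G (f x)) (≡-sym e) fxy)

  inner-avoids : ∀ {a b} → EdgeOf (Path zero) a b → EdgeOf (Path (suc zero)) a b →
                 ∀ y → ¬ EdgeOf (Path (inner y)) a b
  inner-avoids ab₀ ab₁ y ab = inner-not-next-to-both y
    (hole-neighbours {G = G} hole (λ ()) (intersect⇒adj (λ ()) (_ , _ , ab , ab₀)))
    (hole-neighbours {G = G} hole (λ ()) (intersect⇒adj (λ ()) (_ , _ , ab , ab₁)))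

  module _ {s t : Fin m} (st : Adj (graph T) s t)
           (st₀ : EdgeOf (Path zero) s t) (st₁ : EdgeOf (Path (suc zero)) s t)
           (free : ∀ x → ¬ InSplit (Path zero) (Path (suc zero)) x) where
    open TreeMinusEdge T s t

    OnSide : Fin (4 + k) → Set
    OnSide x = ∀ {z} → z ∈ Path x → s ≈ z

    inner-OnSide : ∀ {c} → c ∈ Path (inner zero) → s ≈ c → ∀ y → OnSide (inner y)
    inner-OnSide c∈ s≈c = <-weakInduction (OnSide ∘ inner) (spread zero c∈ s≈c) step
      where
        spread : ∀ y {c} → c ∈ Path (inner y) → s ≈ c → OnSide (inner y)
        spread y c∈ s≈c z∈ = s≈c ◅◅ path-≈ (chain (inner y)) (inner-avoids st₀ st₁ y) c∈ z∈
        step : ∀ y → OnSide (inner (inject₁ y)) → OnSide (inner (suc y))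
        step y side with c , d , cd , cd′ ← consecutive-intersect (CycNext-inner y) =
          spread (suc y) (EdgeOf-∈ cd′) (side (EdgeOf-∈ cd))

    inner-SideEdge : ∀ {c} → c ∈ Path (inner zero) → s ≈ c → ∀ y {x a b} →
                     EdgeOf (Path (inner y)) a b → EdgeOf (Path x) a b → SideEdge (Path x) a b
    inner-SideEdge c∈ s≈c y ab ab′ =
      ab′ , (λ st-ab → inner-avoids st₀ st₁ y (EdgeOf-pair st-ab ab)) , inner-OnSide c∈ s≈c y (EdgeOf-∈ ab)

    inner-off-side : ∀ {c} → c ∈ Path (inner zero) → ¬ s ≈ c
    inner-off-side c∈ s≈c
      with sides-nested T st (unique zero) (unique (suc zero)) (chain zero) (chain (suc zero)) st₀ st₁ free
    ... | inj₁ P₀⊆P₁ with a , b , ab , ab₀ ← consecutive-intersect CycNext-inner-last =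
      chordless (inner (fromℕ (1 + k))) (suc zero) (λ ())
        (λ { (inj₁ ()) ; (inj₂ (_ , ())) }) (λ { (inj₁ ()) ; (inj₂ (() , _)) })
        (intersect⇒adj (λ ()) (a , b , ab , P₀⊆P₁ (inner-SideEdge c∈ s≈c (fromℕ (1 + k)) ab ab₀)))
    ... | inj₂ P₁⊆P₀ with a , b , ab₁ , ab ← consecutive-intersect {suc zero} {inner zero} (inj₁ refl) =
      chordless (inner zero) zero (λ ())
        (λ { (inj₁ ()) ; (inj₂ (() , _)) }) (λ { (inj₁ ()) ; (inj₂ (() , _)) })
        (intersect⇒adj (λ ()) (a , b , ab , P₁⊆P₀ (inner-SideEdge c∈ s≈c zero ab ab₁)))

  first-edge-¬∼ : ¬ Path zero ∼ Path (suc zero)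
  first-edge-¬∼ ((a , b , ab₀ , ab₁) , free)
    with c , d , _ , cd ← consecutive-intersect {suc zero} {inner zero} (inj₁ refl)
       | TreeMinusEdge.sides T a b c
  ... | inj₁ a≈c = inner-off-side (EdgeOf-Adj (graph T) (chain zero) ab₀) ab₀ ab₁ free (EdgeOf-∈ cd) a≈c
  ... | inj₂ b≈c = inner-off-side (EdgeOf-Adj (graph T) (chain zero) (EdgeOf-sym ab₀))
                     (EdgeOf-sym ab₀) (EdgeOf-sym ab₁) free (EdgeOf-∈ cd)
                     (Star.map (λ (adj , ¬ab) → adj , ¬ab ∘ EdgeOf-pair-swap) b≈c)

lemma3 : ∀ {n} (G G' : Graph n) →
         (∀ u v → Adj G' u v → Adj G u v) →
         Representation G G' →
         ∀ k (f : Fin k → Fin n) → 4 ≤ k → IsHole G k f →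
         ∀ i j → CycNext k i j → ¬ Adj G' (f i) (f j)
lemma3 G G' _ R (suc (suc (suc (suc k)))) _ (s≤s (s≤s (s≤s (s≤s z≤n)))) =
  rotation-wlog (IsHole G _) (λ u v → ¬ Adj G' u v) (IsHole-∘next {G = G}) first-edge-¬G′
  where
    open Representation R using (edgeG')
    first-edge-¬G′ : ∀ {f} → IsHole G (4 + k) f → ¬ Adj G' (f zero) (f (suc zero))
    first-edge-¬G′ hole = FirstEdge.first-edge-¬∼ R hole ∘ proj₁ (edgeG' _ _ ((λ ()) ∘ proj₁ (proj₂ (proj₁ hole))))
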